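{- Let $(\Sigma,<)$ be a finite totally ordered alphabet and $w\in\Sigma^+$. If $\mathrm{ICFL}(w)=(m_1,\ldots,m_k)$, then $$\mathrm{CFL}_{in}(w)=(\mathrm{CFL}_{in}(m_1),\ldots,\mathrm{CFL}_{in}(m_k)),$$ the concatenation of the sequences $\mathrm{CFL}_{in}(m_1),\ldots,\mathrm{CFL}_{in}(m_k)$.
   Context: Words are elements of $\Sigma^*$; $1$ empty word, $\Sigma^+=\Sigma^*\setminus\{1\}$. Lexicographic order $\prec$: $x\prec y$ if $x$ is a proper prefix of $y$, or $x=ras$, $y=rbt$ with $a,b\in\Sigma$, $a<b$. For nonempty $x,y$, $x\ll y$ means $x\prec y$ and $x$ not a proper prefix of $y$. $x\le_p y$: $x$ is a prefix of $y$. Inverse order $<_{in}$: $b<_{in}a\iff a<b$; $\prec_{in}$ the induced lexicographic order. An anti-Lyndon word is a nonempty primitive word strictly smaller for $\prec_{in}$ than all its other conjugates. $\mathrm{CFL}_{in}(w)$ is the unique sequence $(\ell_1,\ldots,\ell_h)$ of anti-Lyndon words with $w=\ell_1\cdots\ell_h$ and $\ell_1\succeq_{in}\cdots\succeq_{in}\ell_h$. An inverse Lyndon word is a $u\in\Sigma^+$ with $s\prec u$ for each nonempty proper suffix $s$ of $u$. For $w=pv$ with $p$ an inverse Lyndon nonempty proper prefix, a bounded right extension of $p$ is a nonempty prefix $\overline p$ of $v$ such that $\overline p$ is inverse Lyndon, $pz'$ is inverse Lyndon for every proper nonempty prefix $z'$ of $\overline p$, $p\overline p$ is not inverse Lyndon,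 and $p\ll\overline p$; if $w$ is not inverse Lyndon exactly one such pair exists, the canonical pair of $w$. $\mathrm{ICFL}(w)$: if $w$ is inverse Lyndon, $\mathrm{ICFL}(w)=(w)$; otherwise with canonical pair $(p,\overline p)$, $w=pv$, $\overline p=rb$ ($b\in\Sigma$), $\mathrm{ICFL}(v)=(m'_1,\ldots,m'_{k'})$: $\mathrm{ICFL}(w)=(p,m'_1,\ldots,m'_{k'})$ if $\overline p\le_p m'_1$, and $(pm'_1,m'_2,\ldots,m'_{k'})$ if $m'_1\le_p r$ (exactly one case occurs). -}

module Defs where

open import Data.Nat using (ℕ; _≥_)
open import Data.Fin using (Fin)
import Data.Fin as F
open import Data.List using (List; []; _∷_; _++_; concat; replicate)
open import Data.List.Relation.Unary.Linked using (Linked)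
open import Data.List.Relation.Unary.All using (All)
open import Data.Product using (Σ; ∃; ∃-syntax; _×_)
open import Data.Sum using (_⊎_)
open import Relation.Nullary using (¬_)
open import Relation.Binary.PropositionalEquality using (_≡_; _≢_)

-- Alphabet: a finite totally ordered set, represented (up to order
-- isomorphism) as Fin n with its usual strict order.
Letter : ℕ → Set
Letter n = Fin n

Word : ℕ → Set
Word n = List (Letter n)

module _ {n : ℕ} where

  _≤p_ : Word n → Word n → Set
  x ≤p y = ∃[ z ] (y ≡ x ++ z)

  ProperPrefix : Word n → Word n → Set
  ProperPrefix x y = ∃[ z ] (z ≢ [] × y ≡ x ++ z)

  Lex : (Letter n → Letter n → Set) → Word n → Word n → Set
  Lex R x y =
    ProperPrefix x y
    ⊎ (∃[ r ] ∃[ a ] ∃[ b ] ∃[ s ] ∃[ t ]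
         (x ≡ r ++ (a ∷ s) × y ≡ r ++ (b ∷ t) × R a b))

  _≺_ : Word n → Word n → Set
  _≺_ = Lex F._<_

  _≪_ : Word n → Word n → Set
  x ≪ y = x ≢ [] × y ≢ [] × x ≺ y × ¬ ProperPrefix x y

  _<in_ : Letter n → Letter n → Set
  b <in a = a F.< b

  _≺in_ : Word n → Word n → Set
  _≺in_ = Lex _<in_

  _⪰in_ : Word n → Word n → Set
  x ⪰in y = x ≡ y ⊎ y ≺in x

  Primitive : Word n → Set
  Primitive w = w ≢ [] × ¬ (∃[ u ] ∃[ k ] (k ≥ 2 × w ≡ concat (replicate k u)))

  AntiLyndon : Word n → Set
  AntiLyndon w = Primitive w ×
    (∀ x y → w ≡ x ++ y → y ++ x ≢ w → w ≺in (y ++ x))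

  IsCFLin : Word n → List (Word n) → Set
  IsCFLin w ls = All AntiLyndon ls × w ≡ concat ls × Linked _⪰in_ ls

  InvLyndon : Word n → Set
  InvLyndon u = u ≢ [] ×
    (∀ x s → x ≢ [] → s ≢ [] → u ≡ x ++ s → s ≺ u)

  CanonicalPair : Word n → Word n → Word n → Word n → Set
  CanonicalPair w p v pbar =
    w ≡ p ++ v × p ≢ [] × v ≢ [] × InvLyndon p ×
    pbar ≢ [] × pbar ≤p v × InvLyndon pbar ×
    (∀ z′ → z′ ≢ [] → ProperPrefix z′ pbar → InvLyndon (p ++ z′)) ×
    ¬ InvLyndon (p ++ pbar) ×
    p ≪ pbar

  -- IsICFL w ms : ms = ICFL(w) (inductive reading of the recursive definition)
  data IsICFL : Word n → List (Word n) → Set where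
    icfl-inv : ∀ {w} → InvLyndon w → IsICFL w (w ∷ [])
    icfl-sep : ∀ {w p v pbar r b m′ ms′} →
      ¬ InvLyndon w → CanonicalPair w p v pbar → pbar ≡ r ++ (b ∷ []) →
      IsICFL v (m′ ∷ ms′) → pbar ≤p m′ →
      IsICFL w (p ∷ m′ ∷ ms′)
    icfl-join : ∀ {w p v pbar r b m′ ms′} →
      ¬ InvLyndon w → CanonicalPair w p v pbar → pbar ≡ r ++ (b ∷ []) →
      IsICFL v (m′ ∷ ms′) → m′ ≤p r →
      IsICFL w ((p ++ m′) ∷ ms′)

{-# OPTIONS --safe #-}
module Submission where

-- Concatenating the factorizations CFL_in(m₁), …, CFL_in(m_k) already gives a factorization
-- of w into anti-Lyndon words, so only the order at each junction needs proof: if l is the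
-- last factor of CFL_in(m_i) and h the first factor of y = m_{i+1} ⋯ m_k, then l ⪰in h.
-- Since l is a nonempty suffix of m_i, this follows from two facts.
-- (1) The canonical pair (p, p̄) of ICFL satisfies p ≪ p̄ and makes p q inverse Lyndon for the
--     common prefix q of p and p̄; hence s v ≪ v for every nonempty suffix s of p, where w = p v.
--     Unfolding the recursion, y ≺in s y for every nonempty suffix s of m_i.
-- (2) If l, h are anti-Lyndon, h is a prefix of y and y ≺in l y, then l ⪰in h: the alternatives
--     l ≪in h and "l is a proper prefix of h" both produce l y ≪in y, the second because an
--     anti-Lyndon word is unbordered and hence ≪in-below each of its proper suffixes.

open import Defs
open import Data.Nat using (ℕ; zero; suc; _+_; _≤_; _<_; s≤s; z≤n)
import Data.Nat.Properties as ℕ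
open import Data.Nat.Induction using (<-wellFounded)
open import Induction.WellFounded using (Acc; acc)
import Data.Fin as F
import Data.Fin.Properties as Fin
open import Data.List using (List; []; _∷_; _++_; [_]; concat; replicate; length; last; head)
open import Data.List.Properties
  using (++-assoc; ++-identityʳ; ++-identityʳ-unique; ++-identityˡ-unique; ++-cancelˡ; ++-conicalˡ;
         ∷-injective; ∷-injectiveˡ; length-++; concat-++)
open import Data.List.Relation.Binary.Pointwise using (Pointwise; []; _∷_)
open import Data.List.Relation.Unary.All as All using (All; []; _∷_)
import Data.List.Relation.Unary.All.Properties as All
open import Data.List.Relation.Unary.Linked using (Linked; [])
import Data.List.Relation.Unary.Linked.Properties as Linked
open import Data.Maybe.Relation.Binary.Connected
  using (Connected; just; just-nothing; nothing-just; nothing)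
open import Data.Product using (∃-syntax; _×_; _,_; proj₁)
open import Data.Sum using (_⊎_; inj₁; inj₂)
open import Data.Empty using (⊥; ⊥-elim)
open import Function using (flip)
open import Relation.Nullary using (¬_)
open import Relation.Binary using (IsStrictTotalOrder; tri<; tri≈; tri>)
import Relation.Binary.Construct.Flip.EqAndOrd as Flip
open import Relation.Binary.PropositionalEquality hiding ([_])

module _ {A : Set} where

  ++-split : ∀ (a b c d : List A) → a ++ b ≡ c ++ d →
             (∃[ e ] (c ≡ a ++ e × b ≡ e ++ d)) ⊎ (∃[ e ] (a ≡ c ++ e × d ≡ e ++ b))
  ++-split []      b c       d eq = inj₁ (c , refl , eq)
  ++-split (x ∷ a) b []      d eq = inj₂ (x ∷ a , refl , sym eq)
  ++-split (x ∷ a) b (y ∷ c) d eq with ∷-injective eq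
  ... | refl , eq′ with ++-split a b c d eq′
  ... | inj₁ (e , c≡ae , b≡ed) = inj₁ (e , cong (x ∷_) c≡ae , b≡ed)
  ... | inj₂ (e , a≡ce , d≡eb) = inj₂ (e , cong (x ∷_) a≡ce , d≡eb)

  ++-∷-split : ∀ r {a : A} s r′ {b} s′ → r ++ a ∷ s ≡ r′ ++ b ∷ s′ →
               (r ≡ r′ × a ≡ b × s ≡ s′)
               ⊎ (∃[ e ] (r′ ≡ r ++ a ∷ e × s ≡ e ++ b ∷ s′))
               ⊎ (∃[ e ] (r ≡ r′ ++ b ∷ e × s′ ≡ e ++ a ∷ s))
  ++-∷-split []      s []       s′ refl = inj₁ (refl , refl , refl)
  ++-∷-split []      s (_ ∷ r′) s′ refl = inj₂ (inj₁ (r′ , refl , refl))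
  ++-∷-split (_ ∷ r) s []       s′ refl = inj₂ (inj₂ (r , refl , refl))
  ++-∷-split (x ∷ r) s (y ∷ r′) s′ eq with ∷-injective eq
  ... | refl , eq′ with ++-∷-split r s r′ s′ eq′
  ... | inj₁ (r≡r′ , a≡b , s≡s′)   = inj₁ (cong (x ∷_) r≡r′ , a≡b , s≡s′)
  ... | inj₂ (inj₁ (e , r′≡ , s≡)) = inj₂ (inj₁ (e , cong (x ∷_) r′≡ , s≡))
  ... | inj₂ (inj₂ (e , r≡ , s′≡)) = inj₂ (inj₂ (e , cong (x ∷_) r≡ , s′≡))

  length-≤-++ˡ : ∀ (x y : List A) → length y ≤ length (x ++ y)
  length-≤-++ˡ []      y = ℕ.≤-refl
  length-≤-++ˡ (_ ∷ x) y = ℕ.m≤n⇒m≤1+n (length-≤-++ˡ x y)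

  conjugate-length : ∀ (l t u : List A) → l ++ t ≡ t ++ u → length u ≡ length l
  conjugate-length l t u lt≡tu = ℕ.+-cancelˡ-≡ (length t) _ _ (begin
    length t + length u  ≡⟨ sym (length-++ t) ⟩
    length (t ++ u)      ≡⟨ cong length (sym lt≡tu) ⟩
    length (l ++ t)      ≡⟨ length-++ l ⟩
    length l + length t  ≡⟨ ℕ.+-comm (length l) (length t) ⟩
    length t + length l  ∎)
    where open ≡-Reasoning

  power : List A → ℕ → List A
  power u k = concat (replicate k u)

  power-+ : ∀ u i j → power u i ++ power u j ≡ power u (i + j)
  power-+ u zero    j = refl
  power-+ u (suc i) j = trans (++-assoc u (power u i) (power u j)) (cong (u ++_) (power-+ u i j))

  CommonRoot : List A → List A → Set
  CommonRoot x y = ∃[ u ] ∃[ i ] ∃[ j ] (x ≡ power u i × y ≡ power u j)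

  commonRoot-++ʳ : ∀ {x e} → CommonRoot x e → CommonRoot x (x ++ e)
  commonRoot-++ʳ (u , i , j , x≡ , e≡) = u , i , i + j , x≡ , trans (cong₂ _++_ x≡ e≡) (power-+ u i j)

  commonRoot-++ˡ : ∀ {e y} → CommonRoot e y → CommonRoot (y ++ e) y
  commonRoot-++ˡ (u , i , j , e≡ , y≡) = u , j + i , j , trans (cong₂ _++_ y≡ e≡) (power-+ u j i) , y≡

  ++-comm⇒commonRoot : ∀ (x y : List A) → x ++ y ≡ y ++ x → CommonRoot x y
  ++-comm⇒commonRoot x y = go x y (<-wellFounded (length x + length y))
    where
    go : ∀ x y → Acc _<_ (length x + length y) → x ++ y ≡ y ++ x → CommonRoot x y
    go []      y       _         _  = y , 0 , 1 , refl , sym (++-identityʳ y)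
    go (a ∷ x) []      _         _  = a ∷ x , 1 , 0 , sym (++-identityʳ (a ∷ x)) , refl
    go (a ∷ x) (b ∷ y) (acc rec) eq with ++-split (a ∷ x) (b ∷ y) (b ∷ y) (a ∷ x) eq
    ... | inj₁ (e , refl , xe≡ex) =
          commonRoot-++ʳ
            (go (a ∷ x) e (rec (ℕ.+-monoʳ-< (suc (length x)) (s≤s (length-≤-++ˡ x e)))) xe≡ex)
    ... | inj₂ (e , refl , ye≡ey) =
          commonRoot-++ˡ
            (go e (b ∷ y) (rec (ℕ.+-monoˡ-< (suc (length y)) (s≤s (length-≤-++ˡ y e)))) (sym ye≡ey))

  connected-last-head : ∀ {R : A → A → Set} xs ys →
    (∀ xs₀ x y ys₀ → xs ≡ xs₀ ++ [ x ] → ys ≡ y ∷ ys₀ → R x y) →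
    Connected R (last xs) (head ys)
  connected-last-head []           []       _        = nothing
  connected-last-head []           (_ ∷ _)  _        = nothing-just
  connected-last-head (_ ∷ [])     []       _        = just-nothing
  connected-last-head (x ∷ [])     (y ∷ ys) junction = just (junction [] x y ys refl refl)
  connected-last-head (x ∷ x′ ∷ xs) ys      junction =
    connected-last-head (x′ ∷ xs) ys (λ xs₀ x″ y ys₀ eq → junction (x ∷ xs₀) x″ y ys₀ (cong (x ∷_) eq))

module _ {n : ℕ} where

  -- The second alternative of Lex; for R = F._<_ and nonempty words it is the paper's ≪.
  Mismatch : (Letter n → Letter n → Set) → Word n → Word n → Set
  Mismatch R x y = ∃[ r ] ∃[ a ] ∃[ b ] ∃[ s ] ∃[ t ] (x ≡ r ++ (a ∷ s) × y ≡ r ++ (b ∷ t) × R a b)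

  module _ {R : Letter n → Letter n → Set} where

    mismatch-extendˡ : ∀ {x y} u → Mismatch R x y → Mismatch R (x ++ u) y
    mismatch-extendˡ u (r , a , b , s , t , refl , y≡ , Rab) =
      r , a , b , s ++ u , t , ++-assoc r (a ∷ s) u , y≡ , Rab

    mismatch-extendʳ : ∀ {x y} u → Mismatch R x y → Mismatch R x (y ++ u)
    mismatch-extendʳ u (r , a , b , s , t , x≡ , refl , Rab) =
      r , a , b , s , t ++ u , x≡ , ++-assoc r (b ∷ t) u , Rab

    mismatch-prefix : ∀ {x y} u → Mismatch R x y → Mismatch R (u ++ x) (u ++ y)
    mismatch-prefix u (r , a , b , s , t , refl , refl , Rab) =
      u ++ r , a , b , s , t , sym (++-assoc u r (a ∷ s)) , sym (++-assoc u r (b ∷ t)) , Rab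

    mismatch-flip : ∀ {x y} → Mismatch R x y → Mismatch (flip R) y x
    mismatch-flip (r , a , b , s , t , x≡ , y≡ , Rab) = r , b , a , t , s , y≡ , x≡ , Rab

  properPrefix⇒length< : ∀ {x y : Word n} → ProperPrefix x y → length x < length y
  properPrefix⇒length< ([]    , []≢[] , _)    = ⊥-elim ([]≢[] refl)
  properPrefix⇒length< {x} (_ ∷ e , _     , refl) =
    subst (length x <_) (sym (length-++ x)) (ℕ.m<m+n (length x) (s≤s z≤n))

  ¬properPrefix-++ˡ : ∀ l {x : Word n} → ¬ ProperPrefix (l ++ x) x
  ¬properPrefix-++ˡ l {x} lx⊏x = ℕ.<⇒≱ (properPrefix⇒length< lx⊏x) (length-≤-++ˡ l x)

  commuting⇒¬primitive : ∀ {x y : Word n} → x ≢ [] → y ≢ [] → x ++ y ≡ y ++ x → ¬ Primitive (x ++ y)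
  commuting⇒¬primitive {x} {y} x≢[] y≢[] comm (_ , not-power) with ++-comm⇒commonRoot x y comm
  ... | u , zero  , _     , x≡ , _  = x≢[] x≡
  ... | u , suc i , zero  , _  , y≡ = y≢[] y≡
  ... | u , suc i , suc j , x≡ , y≡ =
        not-power (u , suc i + suc j , s≤s (ℕ.≤-trans (s≤s z≤n) (ℕ.m≤n+m (suc j) i)) ,
                   trans (cong₂ _++_ x≡ y≡) (power-+ u (suc i) (suc j)))

  data Compare (R : Letter n → Letter n → Set) (x y : Word n) : Set where
    equal     : x ≡ y → Compare R x y
    prefix    : ProperPrefix x y → Compare R x y
    extension : ProperPrefix y x → Compare R x y
    below     : Mismatch R x y → Compare R x y
    above     : Mismatch R y x → Compare R x y

  module LexOrder {R : Letter n → Letter n → Set} (R-isSTO : IsStrictTotalOrder _≡_ R) where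

    open IsStrictTotalOrder R-isSTO using (compare) renaming (trans to R-trans; irrefl to R-irrefl)

    lex-irrefl : ∀ {x} → ¬ Lex R x x
    lex-irrefl {x} (inj₁ (e , e≢[] , x≡xe)) = e≢[] (++-identityʳ-unique x x≡xe)
    lex-irrefl (inj₂ (r , a , b , s , t , x≡ , x≡′ , Rab)) =
      R-irrefl (∷-injectiveˡ (++-cancelˡ r _ _ (trans (sym x≡) x≡′))) Rab

    mismatch-trans : ∀ {x y z} → Mismatch R x y → Mismatch R y z → Mismatch R x z
    mismatch-trans (r , a , b , s , t , refl , y≡ , Rab) (r′ , b′ , c , s′ , t′ , y≡′ , refl , Rb′c)
      with ++-∷-split r t r′ s′ (trans (sym y≡) y≡′)
    ... | inj₁ (refl , refl , _)     = r , a , c , s , t′ , refl , refl , R-trans Rab Rb′c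
    ... | inj₂ (inj₁ (e , refl , _)) =
          r , a , b , s , e ++ c ∷ t′ , refl , ++-assoc r (b ∷ e) (c ∷ t′) , Rab
    ... | inj₂ (inj₂ (e , refl , _)) =
          r′ , b′ , c , e ++ a ∷ s , t′ , ++-assoc r′ (b′ ∷ e) (a ∷ s) , refl , Rb′c

    properPrefix-mismatch-lex : ∀ {x y z} → ProperPrefix x y → Mismatch R y z → Lex R x z
    properPrefix-mismatch-lex ([] , []≢[] , _) _ = ⊥-elim ([]≢[] refl)
    properPrefix-mismatch-lex {x} (g ∷ e , _ , refl) (r , b , c , s , t , y≡ , refl , Rbc)
      with ++-∷-split x e r s y≡
    ... | inj₁ (refl , _ , _)        = inj₁ (c ∷ t , (λ ()) , refl)
    ... | inj₂ (inj₁ (f , refl , _)) = inj₁ (g ∷ f ++ c ∷ t , (λ ()) , ++-assoc x (g ∷ f) (c ∷ t))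
    ... | inj₂ (inj₂ (f , refl , _)) = inj₂ (r , b , c , f , t , refl , refl , Rbc)

    lex-mismatch-trans : ∀ {x y z} → Lex R x y → Mismatch R y z → Lex R x z
    lex-mismatch-trans (inj₁ x⊏y) y≪z = properPrefix-mismatch-lex x⊏y y≪z
    lex-mismatch-trans (inj₂ x≪y) y≪z = inj₂ (mismatch-trans x≪y y≪z)

    lex-mismatch-asym : ∀ {x y} → Lex R x y → ¬ Mismatch R y x
    lex-mismatch-asym x≺y y≪x = lex-irrefl (lex-mismatch-trans x≺y y≪x)

    compare-∷ : ∀ a {x y} → Compare R x y → Compare R (a ∷ x) (a ∷ y)
    compare-∷ a (equal x≡y)                  = equal (cong (a ∷_) x≡y)
    compare-∷ a (prefix (e , e≢[] , y≡))     = prefix (e , e≢[] , cong (a ∷_) y≡)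
    compare-∷ a (extension (e , e≢[] , x≡)) = extension (e , e≢[] , cong (a ∷_) x≡)
    compare-∷ a (below m)                    = below (mismatch-prefix [ a ] m)
    compare-∷ a (above m)                    = above (mismatch-prefix [ a ] m)

    compareWords : ∀ x y → Compare R x y
    compareWords []      []      = equal refl
    compareWords []      (b ∷ y) = prefix (b ∷ y , (λ ()) , refl)
    compareWords (a ∷ x) []      = extension (a ∷ x , (λ ()) , refl)
    compareWords (a ∷ x) (b ∷ y) with compare a b
    ... | tri< Rab _ _  = below ([] , a , b , x , y , refl , refl , Rab)
    ... | tri≈ _ refl _ = compare-∷ a (compareWords x y)
    ... | tri> _ _ Rba  = above ([] , b , a , y , x , refl , refl , Rba)

    compare-same-length : ∀ x y → length x ≡ length y → x ≡ y ⊎ Mismatch R x y ⊎ Mismatch R y x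
    compare-same-length x y |x|≡|y| with compareWords x y
    ... | equal x≡y     = inj₁ x≡y
    ... | prefix x⊏y    = ⊥-elim (ℕ.<-irrefl |x|≡|y| (properPrefix⇒length< x⊏y))
    ... | extension y⊏x = ⊥-elim (ℕ.<-irrefl (sym |x|≡|y|) (properPrefix⇒length< y⊏x))
    ... | below m       = inj₂ (inj₁ m)
    ... | above m       = inj₂ (inj₂ m)

  <in-isStrictTotalOrder : IsStrictTotalOrder _≡_ (_<in_ {n})
  <in-isStrictTotalOrder = Flip.isStrictTotalOrder Fin.<-isStrictTotalOrder

  open LexOrder <in-isStrictTotalOrder
  module Lex< = LexOrder (Fin.<-isStrictTotalOrder {n})

  antiLyndon-conjugate-¬≪ : ∀ {h : Word n} → AntiLyndon h →
                            ∀ x y → h ≡ x ++ y → ¬ Mismatch _<in_ (y ++ x) h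
  antiLyndon-conjugate-¬≪ {h} (_ , minimal) x y h≡xy yx≪h =
    lex-mismatch-asym (minimal x y h≡xy yx≢h) yx≪h
    where
    yx≢h : y ++ x ≢ h
    yx≢h yx≡h = lex-irrefl (inj₂ (subst (λ u → Mismatch _<in_ u h) yx≡h yx≪h))

  antiLyndon-unbordered : ∀ {h l t u : Word n} → AntiLyndon h → h ≡ l ++ t → h ≡ t ++ u →
                          l ≢ [] → t ≢ [] → ⊥
  antiLyndon-unbordered {_} {l} {t} {u} h-al h≡lt h≡tu l≢[] t≢[]
    with compare-same-length u l (conjugate-length l t u (trans (sym h≡lt) h≡tu))
  ... | inj₁ refl =
        commuting⇒¬primitive l≢[] t≢[] (trans (sym h≡lt) h≡tu) (subst Primitive h≡lt (proj₁ h-al))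
  ... | inj₂ (inj₁ u≪l) =
        antiLyndon-conjugate-¬≪ h-al t u h≡tu
          (subst (Mismatch _<in_ (u ++ t)) (sym h≡lt) (mismatch-extendʳ t (mismatch-extendˡ t u≪l)))
  ... | inj₂ (inj₂ l≪u) =
        antiLyndon-conjugate-¬≪ h-al l t h≡lt
          (subst (Mismatch _<in_ (t ++ l)) (sym h≡tu) (mismatch-prefix t l≪u))

  antiLyndon-≪-suffix : ∀ {h l t : Word n} → AntiLyndon h → h ≡ l ++ t → l ≢ [] → t ≢ [] →
                        Mismatch _<in_ h t
  antiLyndon-≪-suffix {h} {l} {t} h-al h≡lt l≢[] t≢[] with compareWords t h
  ... | equal refl            = ⊥-elim (l≢[] (++-identityˡ-unique l h≡lt))
  ... | prefix (u , _ , h≡tu) = ⊥-elim (antiLyndon-unbordered h-al h≡lt h≡tu l≢[] t≢[])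
  ... | extension h⊏t         = ⊥-elim (¬properPrefix-++ˡ l (subst (λ v → ProperPrefix v t) h≡lt h⊏t))
  ... | below t≪h             = ⊥-elim (antiLyndon-conjugate-¬≪ h-al l t h≡lt (mismatch-extendˡ l t≪h))
  ... | above h≪t             = h≪t

  antiLyndon-⪰in : ∀ {l h y z : Word n} → AntiLyndon l → AntiLyndon h →
                   y ≡ h ++ z → y ≺in (l ++ y) → l ⪰in h
  antiLyndon-⪰in {l} {h} {_} {z} l-al h-al refl y≺ly with compareWords l h
  ... | equal l≡h      = inj₁ l≡h
  ... | extension h⊏l  = inj₂ (inj₁ h⊏l)
  ... | above h≪l      = inj₂ (inj₂ h≪l)
  ... | below l≪h      =
        ⊥-elim (lex-mismatch-asym y≺ly (mismatch-extendʳ z (mismatch-extendˡ (h ++ z) l≪h)))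
  ... | prefix (t , t≢[] , refl) =
        ⊥-elim (lex-mismatch-asym y≺ly
          (subst (Mismatch _<in_ (l ++ (l ++ t) ++ z)) (sym (++-assoc l t z))
            (mismatch-prefix l (mismatch-extendʳ z (mismatch-extendˡ z
              (antiLyndon-≪-suffix h-al refl (proj₁ (proj₁ l-al)) t≢[]))))))

  ≺⇒≪-raising : ∀ {s q r T : Word n} {a b} → s ≢ [] → (s ++ q) ≺ (q ++ a ∷ r) → a F.< b →
                Mismatch F._<_ (s ++ q) (q ++ b ∷ T)
  ≺⇒≪-raising {s} {q} {r} {T} {a} {b} s≢[] sq≺qar a<b
    with Lex<.lex-mismatch-trans sq≺qar (q , a , b , r , T , refl , refl , a<b)
  ... | inj₂ sq≪qbT               = sq≪qbT
  ... | inj₁ ([] , []≢[] , _)     = ⊥-elim ([]≢[] refl)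
  ... | inj₁ (g ∷ e , _ , qbT≡)
    with ++-∷-split (s ++ q) e q T (sym qbT≡)
  ...   | inj₁ (sq≡q , _ , _)       = ⊥-elim (s≢[] (++-identityˡ-unique s (sym sq≡q)))
  ...   | inj₂ (inj₁ (f , q≡ , _))  = ⊥-elim (¬properPrefix-++ˡ s (g ∷ f , (λ ()) , q≡))
  ...   | inj₂ (inj₂ (f , sq≡ , _)) =
          ⊥-elim (Lex<.lex-mismatch-asym sq≺qar (q , a , b , r , f , refl , sq≡ , a<b))

  invLyndon-suffix-≪ : ∀ {q p₁ T : Word n} {a b} → InvLyndon ((q ++ a ∷ p₁) ++ q) → a F.< b →
                       ∀ t s → q ++ a ∷ p₁ ≡ t ++ s → s ≢ [] →
                       Mismatch F._<_ (s ++ q ++ b ∷ T) (q ++ b ∷ T)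
  invLyndon-suffix-≪ {q} {p₁} {T} {a} {b} _ a<b [] _ refl _ =
    q , a , b , p₁ ++ q ++ b ∷ T , T , ++-assoc q (a ∷ p₁) (q ++ b ∷ T) , refl , a<b
  invLyndon-suffix-≪ {q} {p₁} {T} {a} {b} (_ , suffix-≺) a<b (x ∷ t) s p≡ts s≢[] =
    subst (λ u → Mismatch F._<_ u (q ++ b ∷ T)) (++-assoc s q (b ∷ T))
      (mismatch-extendˡ (b ∷ T) (≺⇒≪-raising s≢[] sq≺qap₁q a<b))
    where
    sq≺pq : (s ++ q) ≺ ((q ++ a ∷ p₁) ++ q)
    sq≺pq = suffix-≺ (x ∷ t) (s ++ q) (λ ()) (λ sq≡[] → s≢[] (++-conicalˡ s q sq≡[]))
              (trans (cong (_++ q) p≡ts) (++-assoc (x ∷ t) s q))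
    sq≺qap₁q : (s ++ q) ≺ (q ++ a ∷ p₁ ++ q)
    sq≺qap₁q = subst ((s ++ q) ≺_) (++-assoc q (a ∷ p₁) q) sq≺pq

  canonicalPair-invLyndon-++ : ∀ {w p v p̄ : Word n} → CanonicalPair w p v p̄ →
                               ∀ q → ProperPrefix q p̄ → InvLyndon (p ++ q)
  canonicalPair-invLyndon-++ {p = p} (_ , _ , _ , p-inv , _) [] _ =
    subst InvLyndon (sym (++-identityʳ p)) p-inv
  canonicalPair-invLyndon-++ (_ , _ , _ , _ , _ , _ , _ , pz-inv , _) (c ∷ q) q⊏p̄ =
    pz-inv (c ∷ q) (λ ()) q⊏p̄

  SuffixesLift : (Word n → Word n → Set) → Word n → Word n → Set
  SuffixesLift _⊲_ m y = ∀ t s → m ≡ t ++ s → s ≢ [] → y ⊲ (s ++ y)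

  canonicalPair-suffixesLift : ∀ {w p v p̄ : Word n} → CanonicalPair w p v p̄ →
                               SuffixesLift (Mismatch _<in_) p v
  canonicalPair-suffixesLift {v = v}
    cp@(_ , _ , _ , _ , _ , (z , v≡p̄z) , _ , _ , _ , (_ , _ , p≺p̄ , p⋢p̄)) t s p≡ts s≢[]
    with p≺p̄
  ... | inj₁ p⊏p̄ = ⊥-elim (p⋢p̄ p⊏p̄)
  ... | inj₂ (q , a , b , p₁ , p̄₁ , refl , refl , a<b) =
        mismatch-flip (subst (λ u → Mismatch F._<_ (s ++ u) u) (sym v≡)
          (invLyndon-suffix-≪ pq-inv a<b t s p≡ts s≢[]))
    where
    pq-inv : InvLyndon ((q ++ a ∷ p₁) ++ q)
    pq-inv = canonicalPair-invLyndon-++ cp q (b ∷ p̄₁ , (λ ()) , refl)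
    v≡ : v ≡ q ++ b ∷ p̄₁ ++ z
    v≡ = trans v≡p̄z (++-assoc q (b ∷ p̄₁) z)

  suffixesLift-[] : ∀ m → SuffixesLift _≺in_ m []
  suffixesLift-[] m t s _ s≢[] = inj₁ (s ++ [] , (λ s[]≡[] → s≢[] (++-conicalˡ s [] s[]≡[])) , refl)

  suffixesLift-≪⇒≺ : ∀ {m y : Word n} → SuffixesLift (Mismatch _<in_) m y → SuffixesLift _≺in_ m y
  suffixesLift-≪⇒≺ lifts t s m≡ts s≢[] = inj₂ (lifts t s m≡ts s≢[])

  suffixesLift-++ : ∀ {p m y : Word n} → m ≢ [] → SuffixesLift _≺in_ m y →
                    SuffixesLift (Mismatch _<in_) p (m ++ y) → SuffixesLift _≺in_ (p ++ m) y
  suffixesLift-++ {p} {m} {y} m≢[] m-lifts p-lifts t s pm≡ts s≢[] with ++-split p m t s pm≡ts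
  ... | inj₁ (e , _ , m≡es)         = m-lifts e s m≡es s≢[]
  ... | inj₂ ([] , _ , refl)         = m-lifts [] m refl m≢[]
  ... | inj₂ (c ∷ e , p≡tce , refl) =
        subst (y ≺in_) (sym (++-assoc (c ∷ e) m y))
          (lex-mismatch-trans (m-lifts [] m refl m≢[]) (p-lifts t (c ∷ e) p≡tce (λ ())))

  data Separated : List (Word n) → Set where
    []  : Separated []
    _∷_ : ∀ {m ms} → SuffixesLift _≺in_ m (concat ms) → Separated ms → Separated (m ∷ ms)

  icfl-concat : ∀ {w : Word n} {ms} → IsICFL w ms → w ≡ concat ms
  icfl-concat {w} (icfl-inv _) = sym (++-identityʳ w)
  icfl-concat (icfl-sep {p = p} _ (w≡pv , _) _ v-icfl _) = trans w≡pv (cong (p ++_) (icfl-concat v-icfl))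
  icfl-concat (icfl-join {p = p} {m′ = m′} {ms′ = ms′} _ (w≡pv , _) _ v-icfl _) =
    trans w≡pv (trans (cong (p ++_) (icfl-concat v-icfl)) (sym (++-assoc p m′ (concat ms′))))

  icfl-head≢[] : ∀ {w : Word n} {m ms} → IsICFL w (m ∷ ms) → m ≢ []
  icfl-head≢[] (icfl-inv (w≢[] , _))            = w≢[]
  icfl-head≢[] (icfl-sep _ (_ , p≢[] , _) _ _ _) = p≢[]
  icfl-head≢[] (icfl-join {p = p} {m′ = m′} _ (_ , p≢[] , _) _ _ _) =
    λ pm′≡[] → p≢[] (++-conicalˡ p m′ pm′≡[])

  icfl-separated : ∀ {w : Word n} {ms} → IsICFL w ms → Separated ms
  icfl-separated (icfl-inv _) = suffixesLift-[] _ ∷ []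
  icfl-separated (icfl-sep {p = p} _ cp _ v-icfl _) =
    suffixesLift-≪⇒≺
      (subst (SuffixesLift (Mismatch _<in_) p) (icfl-concat v-icfl) (canonicalPair-suffixesLift cp))
    ∷ icfl-separated v-icfl
  icfl-separated (icfl-join {p = p} _ cp _ v-icfl _) with icfl-separated v-icfl
  ... | m′-lifts ∷ separated =
        suffixesLift-++ (icfl-head≢[] v-icfl) m′-lifts
          (subst (SuffixesLift (Mismatch _<in_) p) (icfl-concat v-icfl) (canonicalPair-suffixesLift cp))
        ∷ separated

  cfls-antiLyndon : ∀ {ms : List (Word n)} {cs} → Pointwise IsCFLin ms cs → All AntiLyndon (concat cs)
  cfls-antiLyndon []                      = []
  cfls-antiLyndon ((c-al , _ , _) ∷ cfls) = All.++⁺ c-al (cfls-antiLyndon cfls)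

  cfls-concat : ∀ {ms : List (Word n)} {cs} → Pointwise IsCFLin ms cs → concat ms ≡ concat (concat cs)
  cfls-concat [] = refl
  cfls-concat {cs = c ∷ cs} ((_ , m≡c , _) ∷ cfls) =
    trans (cong₂ _++_ m≡c (cfls-concat cfls)) (concat-++ c (concat cs))

  separated⇒linked : ∀ {ms : List (Word n)} {cs} → Separated ms → Pointwise IsCFLin ms cs →
                     Linked _⪰in_ (concat cs)
  separated⇒linked [] [] = []
  separated⇒linked {m ∷ ms} {c ∷ cs} (m-lifts ∷ separated) ((c-al , m≡c , c-linked) ∷ cfls) =
    Linked.++⁺ c-linked (connected-last-head c (concat cs) junction) (separated⇒linked separated cfls)
    where
    junction : ∀ c₀ l h d → c ≡ c₀ ++ [ l ] → concat cs ≡ h ∷ d → l ⪰in h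
    junction c₀ l h d c≡c₀l cs≡hd = antiLyndon-⪰in l-al h-al rest≡ (m-lifts (concat c₀) l m≡c₀l l≢[])
      where
      l-al : AntiLyndon l
      l-al = All.head (All.++⁻ʳ c₀ (subst (All AntiLyndon) c≡c₀l c-al))
      l≢[] : l ≢ []
      l≢[] = proj₁ (proj₁ l-al)
      h-al : AntiLyndon h
      h-al = All.head (subst (All AntiLyndon) cs≡hd (cfls-antiLyndon cfls))
      rest≡ : concat ms ≡ h ++ concat d
      rest≡ = trans (cfls-concat cfls) (cong concat cs≡hd)
      m≡c₀l : m ≡ concat c₀ ++ l
      m≡c₀l = begin
        m                        ≡⟨ m≡c ⟩
        concat c                 ≡⟨ cong concat c≡c₀l ⟩
        concat (c₀ ++ [ l ])     ≡⟨ concat-++ c₀ [ l ] ⟨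
        concat c₀ ++ l ++ []     ≡⟨ cong (concat c₀ ++_) (++-identityʳ l) ⟩
        concat c₀ ++ l           ∎
        where open ≡-Reasoning

corollary8p2 : (n : ℕ) (w : Word n) → w ≢ [] →
    (ms : List (Word n)) → IsICFL w ms →
    (cs : List (List (Word n))) → Pointwise IsCFLin ms cs →
    IsCFLin w (concat cs)
corollary8p2 n w _ ms icfl cs cfls =
  cfls-antiLyndon cfls ,
  trans (icfl-concat icfl) (cfls-concat cfls) ,
  separated⇒linked (icfl-separated icfl) cfls
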